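{- Let $G=(V,E)$ be a graph on $n=|V|$ vertices. Then $v(G)\le\overline{v}(G)+n+e(G)$, and equality holds if and only if $G$ is a disjoint sum of isolated vertices and edges ($K_2$'s).
   Context: For a graph $G$, $v(G)$ (the linear intersection number) is the minimum number $r\ge 0$ such that there exist cliques $C_1,\ldots,C_r\subseteq V$ of $G$ with every edge of $G$ in exactly one $C_i$ and every vertex of $G$ in at least two of the $C_i$ (equivalently, the minimum number of points of a linear hypergraph whose intersection graph is $G$). The reduced linear intersection number $\overline{v}(G)$ is the minimum number $r\ge0$ such that there exist cliques $C_1,\ldots,C_r$ of $G$, each with more than one vertex, such that every edge of $G$ lies in exactly one $C_i$. $e(G)$ denotes the number of isolated vertices (vertices of degree $0$) of $G$. -}

module Defs where

open import Data.Nat using (ℕ; _+_; _≤_)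
open import Data.Bool using (Bool; true; false; not; if_then_else_)
open import Data.Fin using (Fin)
open import Data.Fin.Subset using (Subset; _∈_)
open import Data.List using (List; allFin; map)
open import Data.Bool.ListAction using (any)
open import Data.Nat.ListAction using (sum)
open import Data.Product using (Σ; ∃; _×_)
open import Relation.Binary.PropositionalEquality using (_≡_; _≢_)

record Graph (n : ℕ) : Set where
  field
    adj    : Fin n → Fin n → Bool
    sym    : ∀ u v → adj u v ≡ adj v u
    irrefl : ∀ u → adj u u ≡ false
open Graph public

Edge : ∀ {n} → Graph n → Fin n → Fin n → Set
Edge G u v = adj G u v ≡ true

IsClique : ∀ {n} → Graph n → Subset n → Set
IsClique G C = ∀ u v → u ∈ C → v ∈ C → u ≢ v → Edge G u v

EdgesExactlyOnce : ∀ {n r} → Graph n → (Fin r → Subset n) → Set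
EdgesExactlyOnce {r = r} G C =
  ∀ u v → Edge G u v →
    Σ (Fin r) λ i → (u ∈ C i × v ∈ C i) ×
      (∀ j → u ∈ C j → v ∈ C j → j ≡ i)

LinRep : ∀ {n} → Graph n → ℕ → Set
LinRep {n} G r = Σ (Fin r → Subset n) λ C →
  (∀ i → IsClique G (C i)) × EdgesExactlyOnce G C ×
  (∀ u → Σ (Fin r) λ i → Σ (Fin r) λ j → i ≢ j × u ∈ C i × u ∈ C j)

RedLinRep : ∀ {n} → Graph n → ℕ → Set
RedLinRep {n} G r = Σ (Fin r → Subset n) λ C →
  (∀ i → IsClique G (C i)) ×
  (∀ i → Σ (Fin n) λ a → Σ (Fin n) λ b → a ≢ b × a ∈ C i × b ∈ C i) ×
  EdgesExactlyOnce G C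

IsMin : (ℕ → Set) → ℕ → Set
IsMin P r = P r × (∀ s → P s → r ≤ s)

IsLinNum : ∀ {n} → Graph n → ℕ → Set
IsLinNum G = IsMin (LinRep G)

IsRedLinNum : ∀ {n} → Graph n → ℕ → Set
IsRedLinNum G = IsMin (RedLinRep G)

isolated? : ∀ {n} → Graph n → Fin n → Bool
isolated? {n} G v = not (any (adj G v) (allFin n))

e : ∀ {n} → Graph n → ℕ
e {n} G = sum (map (λ v → if isolated? G v then 1 else 0) (allFin n))

-- G is a disjoint sum of isolated vertices and K₂'s:
-- each vertex has at most one neighbour.
IsMatchingGraph : ∀ {n} → Graph n → Set
IsMatchingGraph G = ∀ u v w → Edge G u v → Edge G u w → v ≡ w

-- Upper bound: a reduced representation is a partition of the edges into v̄ cliques, and it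
-- becomes a linear representation once every vertex lies in two members.  A vertex in d
-- members needs 2 ∸ d extra singleton members: at most 1 if it has a neighbour, 2 if it is
-- isolated, so v ≤ v̄ + n + e.  If some u has two distinct neighbours, one member can be
-- saved: either u already lies in two cliques, or it lies in exactly one clique C, and then
-- C − u together with the pairs {u, y} (y ∈ C − u) and the singletons {y} (y ∉ C) uses only
-- n − 1 new members while every non-isolated vertex is covered twice.
--
-- Lower bound for matching graphs: every clique has at most two vertices.  Let a vertex x
-- have weight 3 ∸ |F| in each member F of a linear representation containing it.  A member
-- carries total weight |F| (3 ∸ |F|) ≤ 2, while a vertex collects at least 3 (at least 4 if
-- isolated), so 3n + e ≤ 2v.  Each member of a reduced representation has two vertices and
-- each vertex lies in at most one member (none if isolated), so 2v̄ + e ≤ n.  Together these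
-- give 2 (v̄ + n + e) ≤ 2v.
module Submission where

open import Defs hiding (sym)
open import Data.Bool using (Bool; true; false; not; if_then_else_; _∨_)
open import Data.Bool.Properties using (T-≡; not-injective)
open import Data.Empty using (⊥-elim)
open import Data.Fin using (Fin; zero; suc; _≟_; _↑ˡ_; _↑ʳ_; splitAt; punchIn; punchOut)
open import Data.Fin.Properties
  using (splitAt-↑ˡ; splitAt-↑ʳ; splitAt⁻¹-↑ˡ; splitAt⁻¹-↑ʳ; ↑ʳ-injective; punchInᵢ≢i; punchIn-injective; punchIn-punchOut)
open import Data.Fin.Subset using (Subset; _∈_; _∉_; _⊆_; ⁅_⁆; _∪_; _─_; _-_; inside; outside)
open import Data.Fin.Subset.Properties
  using (_∈?_; x∈⁅x⁆; x∈⁅y⁆⇒x≡y; x∈p∪q⁺; x∈p∪q⁻; p─q⊆p; x∈p∧x≢y⇒x∈p-y)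
import Data.List as List
open import Data.List.Membership.Propositional.Properties using (∈-allFin)
open import Data.List.Properties using (map-tabulate)
import Data.List.Relation.Unary.Any as Any
open import Data.List.Relation.Unary.Any.Properties using (any⁺; any⁻)
open import Data.Nat using (ℕ; zero; suc; _+_; _*_; _∸_; _≤_; _<_; z≤n; s≤s; _≤?_)
import Data.Nat.ListAction as ℕ
open import Data.Nat.Properties hiding (_≟_)
open import Algebra.Properties.Semiring.Sum +-*-semiring
  using (sum; sum-syntax; sum-cong-≗; sum-remove; sum-replicate-zero; ∑-distrib-+; ∑-comm; *-distribʳ-sum)
open import Data.Nat.Tactic.RingSolver using (solve-∀)
open import Data.Product using (Σ; ∃; ∃₂; _×_; _,_; proj₁; proj₂)
open import Data.Sum as Sum using (_⊎_; inj₁; inj₂; [_,_]′)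
import Data.Vec as Vec
open import Data.Vec.Functional using (Vector; _∷_; _++_; removeAt)
open import Data.Vec.Functional.Properties using (lookup-++ˡ; lookup-++ʳ)
open import Function using (_∘_; id)
open import Function.Bundles using (_⇔_; mk⇔; Equivalence)
open import Relation.Binary.PropositionalEquality
open import Relation.Nullary using (Dec; yes; no; does; ¬_)
open import Relation.Nullary.Decidable using (dec-true; dec-false; _⊎-dec_)
open import Relation.Unary using (Pred; Decidable)

∑-mono-≤ : ∀ {n} {f g : Fin n → ℕ} → (∀ i → f i ≤ g i) → ∑[ i < n ] f i ≤ ∑[ i < n ] g i
∑-mono-≤ {zero}  f≤g = z≤n
∑-mono-≤ {suc n} f≤g = +-mono-≤ (f≤g zero) (∑-mono-≤ (f≤g ∘ suc))

∑-mono-< : ∀ {n} {f g : Fin n → ℕ} j → (∀ i → f i ≤ g i) → f j < g j → ∑[ i < n ] f i < ∑[ i < n ] g i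
∑-mono-< zero    f≤g fⱼ<gⱼ = +-mono-<-≤ fⱼ<gⱼ (∑-mono-≤ (f≤g ∘ suc))
∑-mono-< (suc j) f≤g fⱼ<gⱼ = +-mono-≤-< (f≤g zero) (∑-mono-< j (f≤g ∘ suc) fⱼ<gⱼ)

∑-const : ∀ n c → ∑[ i < n ] c ≡ n * c
∑-const zero    c = refl
∑-const (suc n) c = cong (c +_) (∑-const n c)

f[i]≤∑f : ∀ {n} (f : Fin n → ℕ) i → f i ≤ sum f
f[i]≤∑f f zero    = m≤m+n _ _
f[i]≤∑f f (suc i) = ≤-trans (f[i]≤∑f (f ∘ suc) i) (m≤n+m _ _)

f[i]+f[j]≤∑f : ∀ {n} (f : Fin n → ℕ) {i j} → i ≢ j → f i + f j ≤ sum f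
f[i]+f[j]≤∑f f {zero}  {zero}  i≢j = ⊥-elim (i≢j refl)
f[i]+f[j]≤∑f f {zero}  {suc j} _   = +-monoʳ-≤ (f zero) (f[i]≤∑f (f ∘ suc) j)
f[i]+f[j]≤∑f f {suc i} {zero}  _   = ≤-trans (≤-reflexive (+-comm (f (suc i)) (f zero)))
                                       (+-monoʳ-≤ (f zero) (f[i]≤∑f (f ∘ suc) i))
f[i]+f[j]≤∑f f {suc i} {suc j} i≢j = ≤-trans (f[i]+f[j]≤∑f (f ∘ suc) (i≢j ∘ cong suc)) (m≤n+m _ _)

∑≡0⇒f≡0 : ∀ {n} (f : Fin n → ℕ) → sum f ≡ 0 → ∀ i → f i ≡ 0
∑≡0⇒f≡0 f ∑f≡0 i = n≤0⇒n≡0 (≤-trans (f[i]≤∑f f i) (≤-reflexive ∑f≡0))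

∑>0⇒f>0 : ∀ {n} (f : Fin n → ℕ) → 0 < sum f → ∃ λ i → 0 < f i
∑>0⇒f>0 {suc n} f ∑f>0 with f zero in f₀≡
... | suc _ = zero , subst (0 <_) (sym f₀≡) (s≤s z≤n)
... | zero  = let i , fᵢ>0 = ∑>0⇒f>0 (f ∘ suc) ∑f>0 in suc i , fᵢ>0

∑≥2⇒f>0-twice : ∀ {n} (f : Fin n → ℕ) → (∀ i → f i ≤ 1) → 2 ≤ sum f →
                ∃₂ λ i j → i ≢ j × 0 < f i × 0 < f j
∑≥2⇒f>0-twice {suc n} f f≤1 2≤∑f with ∑>0⇒f>0 f (≤-trans (s≤s z≤n) 2≤∑f)
... | i , fᵢ>0 with ∑>0⇒f>0 (removeAt f i) (+-cancelˡ-≤ 1 1 _ (begin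
                      2                            ≤⟨ 2≤∑f ⟩
                      sum f                        ≡⟨ sum-remove f ⟩
                      f i + sum (removeAt f i)     ≤⟨ +-monoˡ-≤ _ (f≤1 i) ⟩
                      1 + sum (removeAt f i)       ∎))
  where open ≤-Reasoning
...   | j , fⱼ>0 = i , punchIn i j , punchInᵢ≢i i j ∘ sym , fᵢ>0 , fⱼ>0

listSum-tabulate : ∀ {n} (f : Fin n → ℕ) → ℕ.sum (List.tabulate f) ≡ ∑[ i < n ] f i
listSum-tabulate {zero}  f = refl
listSum-tabulate {suc n} f = cong (f zero +_) (listSum-tabulate (f ∘ suc))

𝟙 : Bool → ℕ
𝟙 b = if b then 1 else 0

𝟙≤1 : ∀ b → 𝟙 b ≤ 1
𝟙≤1 true  = ≤-refl
𝟙≤1 false = z≤n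

𝟙-∨ : ∀ b c → 𝟙 (b ∨ c) ≤ 𝟙 b + 𝟙 c
𝟙-∨ true  c = s≤s z≤n
𝟙-∨ false c = ≤-refl

𝟙-yes : ∀ {a} {A : Set a} (a? : Dec A) → A → 𝟙 (does a?) ≡ 1
𝟙-yes a? a = cong 𝟙 (dec-true a? a)

𝟙-no : ∀ {a} {A : Set a} (a? : Dec A) → ¬ A → 𝟙 (does a?) ≡ 0
𝟙-no a? ¬a = cong 𝟙 (dec-false a? ¬a)

𝟙>0⇒ : ∀ {a} {A : Set a} (a? : Dec A) → 0 < 𝟙 (does a?) → A
𝟙>0⇒ (yes a) _ = a

𝟙-mono : ∀ {a b} {A : Set a} {B : Set b} → (A → B) → (a? : Dec A) (b? : Dec B) → 𝟙 (does a?) ≤ 𝟙 (does b?)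
𝟙-mono A→B (yes a) b? = ≤-reflexive (sym (𝟙-yes b? (A→B a)))
𝟙-mono A→B (no _)  b? = z≤n

count : ∀ {n p} {P : Pred (Fin n) p} → Decidable P → ℕ
count {n} P? = ∑[ i < n ] 𝟙 (does (P? i))

count-mono : ∀ {n p q} {P : Pred (Fin n) p} {Q : Pred (Fin n) q} (P? : Decidable P) (Q? : Decidable Q) →
             (∀ {j} → P j → Q j) → count P? ≤ count Q?
count-mono P? Q? P⊆Q = ∑-mono-≤ (λ j → 𝟙-mono P⊆Q (P? j) (Q? j))

count-≟ : ∀ {n} (i : Fin n) → count (_≟ i) ≡ 1
count-≟ {suc n} zero    = cong suc (sum-replicate-zero n)
count-≟ {suc n} (suc i) = count-≟ i

module _ {n p} {P : Pred (Fin n) p} (P? : Decidable P) where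

  count≡0 : (∀ j → ¬ P j) → count P? ≡ 0
  count≡0 ¬P = n≤0⇒n≡0 (begin
    count P?      ≤⟨ ∑-mono-≤ (λ j → ≤-reflexive (𝟙-no (P? j) (¬P j))) ⟩
    ∑[ j < n ] 0  ≡⟨ sum-replicate-zero n ⟩
    0             ∎)
    where open ≤-Reasoning

  count≤1 : ∀ {i} → (∀ {j} → P j → j ≡ i) → count P? ≤ 1
  count≤1 {i} P⊆≡i = ≤-trans (count-mono P? (_≟ i) P⊆≡i) (≤-reflexive (count-≟ i))

  count≤2 : ∀ {a b} → (∀ {j} → P j → j ≡ a ⊎ j ≡ b) → count P? ≤ 2
  count≤2 {a} {b} P⊆ab = begin
    count P?                                          ≤⟨ count-mono P? (λ j → (j ≟ a) ⊎-dec (j ≟ b)) P⊆ab ⟩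
    ∑[ j < n ] 𝟙 (does (j ≟ a) ∨ does (j ≟ b))        ≤⟨ ∑-mono-≤ (λ j → 𝟙-∨ (does (j ≟ a)) (does (j ≟ b))) ⟩
    ∑[ j < n ] (𝟙 (does (j ≟ a)) + 𝟙 (does (j ≟ b)))  ≡⟨ ∑-distrib-+ (λ j → 𝟙 (does (j ≟ a))) _ ⟩
    count (_≟ a) + count (_≟ b)                       ≡⟨ cong₂ _+_ (count-≟ a) (count-≟ b) ⟩
    2                                                 ∎
    where open ≤-Reasoning

  1≤count : ∀ {i} → P i → 1 ≤ count P?
  1≤count {i} pᵢ = ≤-trans (≤-reflexive (sym (𝟙-yes (P? i) pᵢ))) (f[i]≤∑f _ i)

  2≤count : ∀ {i j} → i ≢ j → P i → P j → 2 ≤ count P?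
  2≤count {i} {j} i≢j pᵢ pⱼ =
    ≤-trans (≤-reflexive (sym (cong₂ _+_ (𝟙-yes (P? i) pᵢ) (𝟙-yes (P? j) pⱼ)))) (f[i]+f[j]≤∑f _ i≢j)

  count≡1 : ∀ {i} → P i → (∀ {j} → P j → j ≡ i) → count P? ≡ 1
  count≡1 pᵢ P⊆≡i = ≤-antisym (count≤1 P⊆≡i) (1≤count pᵢ)

  2≤count⇒ : 2 ≤ count P? → ∃₂ λ i j → i ≢ j × P i × P j
  2≤count⇒ 2≤c with ∑≥2⇒f>0-twice (𝟙 ∘ does ∘ P?) (𝟙≤1 ∘ does ∘ P?) 2≤c
  ... | i , j , i≢j , 𝟙ᵢ>0 , 𝟙ⱼ>0 = i , j , i≢j , 𝟙>0⇒ (P? i) 𝟙ᵢ>0 , 𝟙>0⇒ (P? j) 𝟙ⱼ>0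

∈⁅⁆-unique : ∀ {n} (x : Fin n) {u v} → u ∈ ⁅ x ⁆ → v ∈ ⁅ x ⁆ → u ≡ v
∈⁅⁆-unique x u∈ v∈ = trans (x∈⁅y⁆⇒x≡y x u∈) (sym (x∈⁅y⁆⇒x≡y x v∈))

x∈p─q⇒x∉q : ∀ {n} {x : Fin n} {p q : Subset n} → x ∈ p ─ q → x ∉ q
x∈p─q⇒x∉q {x = zero}  {_ Vec.∷ _} {inside  Vec.∷ _} ()                _
x∈p─q⇒x∉q {x = zero}  {_ Vec.∷ _} {outside Vec.∷ _} _                 ()
x∈p─q⇒x∉q {x = suc _} {_ Vec.∷ _} {_ Vec.∷ _}       (Vec.there x∈p─q) (Vec.there x∈q) = x∈p─q⇒x∉q x∈p─q x∈q

another : ∀ {n} {S : Subset n} {a b} → a ≢ b → a ∈ S → b ∈ S → ∀ x → ∃ λ y → y ∈ S × y ≢ x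
another {a = a} a≢b a∈S b∈S x with a ≟ x
... | yes refl = _ , b∈S , a≢b ∘ sym
... | no  a≢x  = a , a∈S , a≢x

↑ˡ≢↑ʳ : ∀ {m n} (k : Fin m) (j : Fin n) → k ↑ˡ n ≢ m ↑ʳ j
↑ˡ≢↑ʳ {m} {n} k j eq with () ← trans (sym (splitAt-↑ˡ m k n)) (trans (cong (splitAt m) eq) (splitAt-↑ʳ m n j))

++-elim : ∀ {a p} {A : Set a} {m n} (P : Fin (m + n) → A → Set p) {xs : Vector A m} {ys : Vector A n} →
          (∀ k → P (k ↑ˡ n) (xs k)) → (∀ k → P (m ↑ʳ k) (ys k)) → ∀ j → P j ((xs ++ ys) j)
++-elim {m = m} {n} P {xs} {ys} left right j = go (splitAt m j) refl
  where
  go : ∀ s → splitAt m j ≡ s → P j ([ xs , ys ]′ s)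
  go (inj₁ k) eq = subst (λ j → P j (xs k)) (splitAt⁻¹-↑ˡ eq) (left k)
  go (inj₂ k) eq = subst (λ j → P j (ys k)) (splitAt⁻¹-↑ʳ eq) (right k)

module _ {n} (G : Graph n) where

  edge⇒≢ : ∀ {u v} → Edge G u v → u ≢ v
  edge⇒≢ {u} uv refl with () ← trans (sym uv) (irrefl G u)

  edge-sym : ∀ {u v} → Edge G u v → Edge G v u
  edge-sym {u} {v} uv = trans (Graph.sym G v u) uv

  edge⇒¬isolated : ∀ {x y} → Edge G x y → isolated? G x ≡ false
  edge⇒¬isolated {x} {y} xy = cong not (Equivalence.to T-≡
    (any⁺ (adj G x) (Any.map (λ { refl → Equivalence.from T-≡ xy }) (∈-allFin y))))

  isolated⇒¬edge : ∀ {x y} → isolated? G x ≡ true → ¬ Edge G x y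
  isolated⇒¬edge iso xy with () ← trans (sym iso) (edge⇒¬isolated xy)

  ¬isolated⇒edge : ∀ {x} → isolated? G x ≡ false → ∃ (Edge G x)
  ¬isolated⇒edge {x} ¬iso =
    let y , xy = Any.satisfied (any⁻ (adj G x) (List.allFin n) (Equivalence.from T-≡ (not-injective ¬iso)))
    in y , Equivalence.to T-≡ xy

  e≡∑ : e G ≡ ∑[ x < n ] 𝟙 (isolated? G x)
  e≡∑ = trans (cong ℕ.sum (map-tabulate id (𝟙 ∘ isolated? G))) (listSum-tabulate (𝟙 ∘ isolated? G))

  ∑[1+isolated]≡n+e : ∑[ x < n ] (1 + 𝟙 (isolated? G x)) ≡ n + e G
  ∑[1+isolated]≡n+e = trans (∑-distrib-+ (λ _ → 1) (𝟙 ∘ isolated? G))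
                            (cong₂ _+_ (trans (∑-const n 1) (*-identityʳ n)) (sym e≡∑))

  clique-⊆ : ∀ {S T} → S ⊆ T → IsClique G T → IsClique G S
  clique-⊆ S⊆T T-clique u v u∈S v∈S = T-clique u v (S⊆T u∈S) (S⊆T v∈S)

  ⁅⁆-clique : ∀ x → IsClique G ⁅ x ⁆
  ⁅⁆-clique x u v u∈ v∈ u≢v = ⊥-elim (u≢v (∈⁅⁆-unique x u∈ v∈))

  clique-isolated : ∀ {S x y} → IsClique G S → x ∈ S → isolated? G x ≡ true → y ∈ S → y ≡ x
  clique-isolated {x = x} {y} S-clique x∈S iso y∈S with y ≟ x
  ... | yes y≡x = y≡x
  ... | no  y≢x = ⊥-elim (isolated⇒¬edge iso (S-clique x y x∈S y∈S (y≢x ∘ sym)))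

-- Clique partitions

CoveredOnce : ∀ {n r} → (Fin r → Subset n) → Fin n → Fin n → Set
CoveredOnce {r = r} C u v = Σ (Fin r) λ i → (u ∈ C i × v ∈ C i) × (∀ j → u ∈ C j → v ∈ C j → j ≡ i)

coveredOnce-sym : ∀ {n r} {C : Fin r → Subset n} {u v} → CoveredOnce C u v → CoveredOnce C v u
coveredOnce-sym (i , (u∈Cᵢ , v∈Cᵢ) , unique) = i , (v∈Cᵢ , u∈Cᵢ) , λ j v∈Cⱼ u∈Cⱼ → unique j u∈Cⱼ v∈Cⱼ

record IsCliquePartition {n r} (G : Graph n) (C : Fin r → Subset n) : Set where
  constructor cliquePartition
  field
    cliques : ∀ i → IsClique G (C i)
    once    : EdgesExactlyOnce G C

open IsCliquePartition public

degree : ∀ {n r} → (Fin r → Subset n) → Fin n → ℕ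
degree C x = count (λ i → x ∈? C i)

2∸degree≤1 : ∀ {n r} {C : Fin r → Subset n} {x i} → x ∈ C i → 2 ∸ degree C x ≤ 1
2∸degree≤1 {C = C} {x} x∈Cᵢ = ∸-monoʳ-≤ 2 (1≤count (λ i → x ∈? C i) x∈Cᵢ)

2∸degree≡0 : ∀ {n r} {C : Fin r → Subset n} {x i j} → i ≢ j → x ∈ C i → x ∈ C j → 2 ∸ degree C x ≡ 0
2∸degree≡0 {C = C} {x} i≢j x∈Cᵢ x∈Cⱼ = m≤n⇒m∸n≡0 (2≤count (λ i → x ∈? C i) i≢j x∈Cᵢ x∈Cⱼ)

deficit : ∀ {n r} → (Fin r → Subset n) → ℕ
deficit {n} C = ∑[ x < n ] (2 ∸ degree C x)

module _ {n} {G : Graph n} where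

  ⁅⁆∷-partition : ∀ {r} {C : Fin r → Subset n} x → IsCliquePartition G C → IsCliquePartition G (⁅ x ⁆ ∷ C)
  ⁅⁆∷-partition {C = C} x P = cliquePartition cliques′ once′
    where
    cliques′ : ∀ i → IsClique G ((⁅ x ⁆ ∷ C) i)
    cliques′ zero    = ⁅⁆-clique G x
    cliques′ (suc i) = cliques P i
    once′ : EdgesExactlyOnce G (⁅ x ⁆ ∷ C)
    once′ u v uv with once P u v uv
    ... | i , uv∈Cᵢ , unique = suc i , uv∈Cᵢ , λ
      { zero    u∈ v∈ → ⊥-elim (edge⇒≢ G uv (∈⁅⁆-unique x u∈ v∈))
      ; (suc j) u∈ v∈ → cong suc (unique j u∈ v∈) }

  deficit-⁅⁆∷ : ∀ {r} {C : Fin r → Subset n} {x} → degree C x < 2 → suc (deficit (⁅ x ⁆ ∷ C)) ≡ deficit C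
  deficit-⁅⁆∷ {C = C} {x} degree<2 = begin
    suc (deficit (⁅ x ⁆ ∷ C))                  ≡⟨ +-comm 1 _ ⟩
    deficit (⁅ x ⁆ ∷ C) + 1                    ≡⟨ cong (deficit (⁅ x ⁆ ∷ C) +_) (count≡1 (_∈? ⁅ x ⁆) (x∈⁅x⁆ x) (x∈⁅y⁆⇒x≡y x)) ⟨
    deficit (⁅ x ⁆ ∷ C) + count (_∈? ⁅ x ⁆)    ≡⟨ ∑-distrib-+ (λ y → 2 ∸ degree (⁅ x ⁆ ∷ C) y) _ ⟨
    ∑[ y < n ] (2 ∸ (δ y + degree C y) + δ y)  ≡⟨ sum-cong-≗ pointwise ⟩
    deficit C                                  ∎
    where
    open ≡-Reasoning
    δ : Fin n → ℕ
    δ y = 𝟙 (does (y ∈? ⁅ x ⁆))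
    2∸[1+d]+1 : ∀ d → d < 2 → 2 ∸ suc d + 1 ≡ 2 ∸ d
    2∸[1+d]+1 0 _ = refl
    2∸[1+d]+1 1 _ = refl
    2∸[1+d]+1 (suc (suc _)) (s≤s (s≤s ()))
    pointwise : ∀ y → 2 ∸ (𝟙 (does (y ∈? ⁅ x ⁆)) + degree C y) + 𝟙 (does (y ∈? ⁅ x ⁆)) ≡ 2 ∸ degree C y
    pointwise y with y ∈? ⁅ x ⁆
    ... | no  _     = +-identityʳ _
    ... | yes y∈⁅x⁆ rewrite x∈⁅y⁆⇒x≡y x y∈⁅x⁆ = 2∸[1+d]+1 _ degree<2

  partition⇒linRep : ∀ {r} {C : Fin r → Subset n} → IsCliquePartition G C → LinRep G (r + deficit C)
  partition⇒linRep P = go _ P refl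
    where
    go : ∀ k {r} {C : Fin r → Subset n} → IsCliquePartition G C → deficit C ≡ k → LinRep G (r + k)
    go zero {r} {C} P deficit≡0 = subst (LinRep G) (sym (+-identityʳ r)) (C , cliques P , once P , λ x →
      2≤count⇒ (λ i → x ∈? C i) (m∸n≡0⇒m≤n (∑≡0⇒f≡0 (λ y → 2 ∸ degree C y) deficit≡0 x)))
    go (suc k) {r} {C} P deficit≡1+k
      with ∑>0⇒f>0 (λ y → 2 ∸ degree C y) (subst (0 <_) (sym deficit≡1+k) (s≤s z≤n))
    ... | x , 2∸degree>0 = subst (LinRep G) (sym (+-suc r k)) (go k (⁅⁆∷-partition x P)
      (suc-injective (trans (deficit-⁅⁆∷ {C = C} (m∸n≢0⇒n<m (m<n⇒n≢0 2∸degree>0))) deficit≡1+k)))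

  2∸degree≤1+isolated : ∀ {r} {C : Fin r → Subset n} → IsCliquePartition G C →
                        ∀ x → 2 ∸ degree C x ≤ 1 + 𝟙 (isolated? G x)
  2∸degree≤1+isolated {C = C} P x with isolated? G x in iso
  ... | true  = m∸n≤m 2 (degree C x)
  ... | false with ¬isolated⇒edge G iso
  ...   | y , xy = 2∸degree≤1 {C = C} (proj₁ (proj₁ (proj₂ (once P x y xy))))

  deficit≤n+e : ∀ {r} {C : Fin r → Subset n} → IsCliquePartition G C → deficit C ≤ n + e G
  deficit≤n+e P = ≤-trans (∑-mono-≤ (2∸degree≤1+isolated P)) (≤-reflexive (∑[1+isolated]≡n+e G))

  deficit<n+e : ∀ {r} {C : Fin r → Subset n} {u} → IsCliquePartition G C → 2 ≤ degree C u → deficit C < n + e G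
  deficit<n+e {u = u} P 2≤degree = <-≤-trans
    (∑-mono-< u (2∸degree≤1+isolated P) (subst (_< 1 + 𝟙 (isolated? G u)) (sym (m≤n⇒m∸n≡0 2≤degree)) (s≤s z≤n)))
    (≤-reflexive (∑[1+isolated]≡n+e G))

-- Splitting off a vertex

module SplitOff {m r} {G : Graph (suc m)} {C : Fin r → Subset (suc m)} (P : IsCliquePartition G C)
                {u : Fin (suc m)} {i : Fin r} (u∈Cᵢ : u ∈ C i) (only : ∀ k → u ∈ C k → k ≡ i) where

  link : Fin (suc m) → Subset (suc m)
  link y with y ∈? C i
  ... | yes _ = ⁅ u ⁆ ∪ ⁅ y ⁆
  ... | no  _ = ⁅ y ⁆

  ∈link : ∀ {y z} → z ∈ link y → z ≡ u ⊎ z ≡ y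
  ∈link {y} z∈ with y ∈? C i
  ... | yes _ = Sum.map (x∈⁅y⁆⇒x≡y u) (x∈⁅y⁆⇒x≡y y) (x∈p∪q⁻ ⁅ u ⁆ ⁅ y ⁆ z∈)
  ... | no  _ = inj₂ (x∈⁅y⁆⇒x≡y y z∈)

  ∈link-≢ : ∀ {y z} → z ∈ link y → z ≢ u → z ≡ y
  ∈link-≢ z∈ z≢u = [ ⊥-elim ∘ z≢u , id ]′ (∈link z∈)

  y∈link : ∀ y → y ∈ link y
  y∈link y with y ∈? C i
  ... | yes _ = x∈p∪q⁺ (inj₂ (x∈⁅x⁆ y))
  ... | no  _ = x∈⁅x⁆ y

  u∈link : ∀ {y} → y ∈ C i → u ∈ link y
  u∈link {y} y∈Cᵢ with y ∈? C i
  ... | yes _    = x∈p∪q⁺ (inj₁ (x∈⁅x⁆ u))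
  ... | no y∉Cᵢ = ⊥-elim (y∉Cᵢ y∈Cᵢ)

  link-clique : ∀ y → IsClique G (link y)
  link-clique y with y ∈? C i
  ... | yes y∈Cᵢ = clique-⊆ G ⊆Cᵢ (cliques P i)
    where
    ⊆Cᵢ : ⁅ u ⁆ ∪ ⁅ y ⁆ ⊆ C i
    ⊆Cᵢ z∈ with x∈p∪q⁻ ⁅ u ⁆ ⁅ y ⁆ z∈
    ... | inj₁ z∈⁅u⁆ = subst (_∈ C i) (sym (x∈⁅y⁆⇒x≡y u z∈⁅u⁆)) u∈Cᵢ
    ... | inj₂ z∈⁅y⁆ = subst (_∈ C i) (sym (x∈⁅y⁆⇒x≡y y z∈⁅y⁆)) y∈Cᵢ
  ... | no  _    = ⁅⁆-clique G y

  neighbour∈Cᵢ : ∀ {q} → Edge G u q → q ∈ C i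
  neighbour∈Cᵢ {q} uq with once P u q uq
  ... | k , (u∈Cₖ , q∈Cₖ) , _ = subst (λ k → q ∈ C k) (only k u∈Cₖ) q∈Cₖ

  -- The new members link y are indexed by the vertices y ≢ u, through punchIn u.
  split : Fin (r + m) → Subset (suc m)
  split = (λ k → C k - u) ++ removeAt link u

  slot : ∀ {y} → y ≢ u → Fin m
  slot y≢u = punchOut (y≢u ∘ sym)

  slot-injective : ∀ {y z} (y≢u : y ≢ u) (z≢u : z ≢ u) → slot y≢u ≡ slot z≢u → y ≡ z
  slot-injective y≢u z≢u eq = begin
    _                     ≡⟨ punchIn-punchOut (y≢u ∘ sym) ⟨
    punchIn u (slot y≢u)  ≡⟨ cong (punchIn u) eq ⟩
    punchIn u (slot z≢u)  ≡⟨ punchIn-punchOut (z≢u ∘ sym) ⟩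
    _                     ∎
    where open ≡-Reasoning

  split-slot : ∀ {y} (y≢u : y ≢ u) → split (r ↑ʳ slot y≢u) ≡ link y
  split-slot y≢u = trans (lookup-++ʳ (λ k → C k - u) (removeAt link u) (slot y≢u))
                         (cong link (punchIn-punchOut (y≢u ∘ sym)))

  slot-unique : ∀ {y} (y≢u : y ≢ u) {j} → y ∈ link (punchIn u j) → r ↑ʳ j ≡ r ↑ʳ slot y≢u
  slot-unique y≢u y∈ = cong (r ↑ʳ_) (punchIn-injective u _ _
    (trans (sym (∈link-≢ y∈ y≢u)) (sym (punchIn-punchOut (y≢u ∘ sym)))))

  y∈split-slot : ∀ {y} (y≢u : y ≢ u) → y ∈ split (r ↑ʳ slot y≢u)
  y∈split-slot {y} y≢u = subst (y ∈_) (sym (split-slot y≢u)) (y∈link y)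

  u∈split-slot : ∀ {q} (uq : Edge G u q) → u ∈ split (r ↑ʳ slot (edge⇒≢ G (edge-sym G uq)))
  u∈split-slot uq = subst (u ∈_) (sym (split-slot (edge⇒≢ G (edge-sym G uq)))) (u∈link (neighbour∈Cᵢ uq))

  y∈split-↑ˡ : ∀ {y k} → y ∈ C k → y ≢ u → y ∈ split (k ↑ˡ m)
  y∈split-↑ˡ {y} {k} y∈Cₖ y≢u = subst (y ∈_) (sym (lookup-++ˡ (λ k → C k - u) (removeAt link u) k))
                                      (x∈p∧x≢y⇒x∈p-y y∈Cₖ y≢u)

  covered-at-u : ∀ {q} → Edge G u q → CoveredOnce split u q
  covered-at-u {q} uq = r ↑ʳ slot q≢u
                      , (u∈split-slot uq , y∈split-slot q≢u)
                      , ++-elim (λ j S → u ∈ S → q ∈ S → j ≡ r ↑ʳ slot q≢u)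
                          (λ k u∈ _ → ⊥-elim (x∈p─q⇒x∉q u∈ (x∈⁅x⁆ u)))
                          (λ j _ q∈ → slot-unique q≢u {j} q∈)
    where
    q≢u : q ≢ u
    q≢u = edge⇒≢ G (edge-sym G uq)

  covered-away : ∀ {p q} → p ≢ u → q ≢ u → Edge G p q → CoveredOnce split p q
  covered-away {p} {q} p≢u q≢u pq with once P p q pq
  ... | k , (p∈Cₖ , q∈Cₖ) , unique =
        k ↑ˡ m
      , (y∈split-↑ˡ p∈Cₖ p≢u , y∈split-↑ˡ q∈Cₖ q≢u)
      , ++-elim (λ j S → p ∈ S → q ∈ S → j ≡ k ↑ˡ m)
          (λ k′ p∈ q∈ → cong (_↑ˡ m) (unique k′ (p─q⊆p _ _ p∈) (p─q⊆p _ _ q∈)))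
          (λ j p∈ q∈ → ⊥-elim (edge⇒≢ G pq (trans (∈link-≢ {punchIn u j} p∈ p≢u) (sym (∈link-≢ q∈ q≢u)))))

  split-partition : IsCliquePartition G split
  split-partition = cliquePartition
    (++-elim (λ _ S → IsClique G S) (λ k → clique-⊆ G (p─q⊆p (C k) ⁅ u ⁆) (cliques P k)) (link-clique ∘ punchIn u))
    once′
    where
    once′ : EdgesExactlyOnce G split
    once′ p q pq with p ≟ u | q ≟ u
    ... | yes refl | _        = covered-at-u pq
    ... | no  p≢u  | yes refl = coveredOnce-sym (covered-at-u (edge-sym G pq))
    ... | no  p≢u  | no  q≢u  = covered-away p≢u q≢u pq

  split-deficit : ∀ {a b} → Edge G u a → Edge G u b → a ≢ b → deficit split ≤ e G
  split-deficit {a} {b} ua ub a≢b = begin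
    deficit split                     ≤⟨ ∑-mono-≤ pointwise ⟩
    ∑[ y < suc m ] 𝟙 (isolated? G y)  ≡⟨ e≡∑ G ⟨
    e G                               ∎
    where
    open ≤-Reasoning
    a≢u = edge⇒≢ G (edge-sym G ua)
    b≢u = edge⇒≢ G (edge-sym G ub)
    slots-differ : r ↑ʳ slot a≢u ≢ r ↑ʳ slot b≢u
    slots-differ = a≢b ∘ slot-injective a≢u b≢u ∘ ↑ʳ-injective r _ _
    pointwise : ∀ y → 2 ∸ degree split y ≤ 𝟙 (isolated? G y)
    pointwise y with y ≟ u
    ... | yes refl = ≤-trans (≤-reflexive (2∸degree≡0 {C = split} slots-differ (u∈split-slot ua) (u∈split-slot ub))) z≤n
    ... | no  y≢u with isolated? G y in iso
    ...   | true  = 2∸degree≤1 {C = split} (y∈split-slot y≢u)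
    ...   | false with ¬isolated⇒edge G iso
    ...     | z , yz with once P y z yz
    ...       | k , (y∈Cₖ , _) , _ = ≤-trans (≤-reflexive (2∸degree≡0 {C = split} (↑ˡ≢↑ʳ k (slot y≢u))
                                       (y∈split-↑ˡ y∈Cₖ y≢u) (y∈split-slot y≢u))) z≤n

two-neighbours⇒shorter : ∀ {n r} {G : Graph n} {C : Fin r → Subset n} → IsCliquePartition G C →
                         ∀ {u a b} → Edge G u a → Edge G u b → a ≢ b → ∃ λ s → LinRep G s × s < r + n + e G
two-neighbours⇒shorter {n} {r} {G} {C} P {u} ua ub a≢b with 2 ≤? degree C u
... | yes 2≤degree = r + deficit C , partition⇒linRep P ,
  subst (r + deficit C <_) (sym (+-assoc r n (e G))) (+-monoʳ-< r (deficit<n+e {u = u} P 2≤degree))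
two-neighbours⇒shorter {suc m} {r} {G} {C} P {u} ua ub a≢b | no 2≰degree with once P u _ ua
... | i , (u∈Cᵢ , _) , _ = r + m + deficit split , partition⇒linRep split-partition ,
  +-mono-<-≤ (+-monoʳ-< r (n<1+n m)) (split-deficit ua ub a≢b)
  where
  only : ∀ k → u ∈ C k → k ≡ i
  only k u∈Cₖ with k ≟ i
  ... | yes k≡i = k≡i
  ... | no  k≢i = ⊥-elim (2≰degree (2≤count (λ k → u ∈? C k) k≢i u∈Cₖ u∈Cᵢ))
  open SplitOff P u∈Cᵢ only

-- Matching graphs

size : ∀ {n} → Subset n → ℕ
size S = count (_∈? S)

k*[3∸k]≤2 : ∀ k → k * (3 ∸ k) ≤ 2
k*[3∸k]≤2 0 = z≤n
k*[3∸k]≤2 1 = ≤-refl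
k*[3∸k]≤2 2 = ≤-refl
k*[3∸k]≤2 (suc (suc (suc k))) rewrite 0∸n≡0 k | *-zeroʳ k = z≤n

module Matching {n} {G : Graph n} (M : IsMatchingGraph G) where

  clique-partner : ∀ {S x p y} → IsClique G S → x ∈ S → Edge G x p → y ∈ S → y ≡ x ⊎ y ≡ p
  clique-partner {x = x} {p} {y} S-clique x∈S xp y∈S with y ≟ x
  ... | yes y≡x = inj₁ y≡x
  ... | no  y≢x = inj₂ (M x y p (S-clique x y x∈S y∈S (y≢x ∘ sym)) xp)

  reduced-bound : ∀ {r} → RedLinRep G r → r * 2 + e G ≤ n
  reduced-bound {r} (R , R-cliques , R-pairs , R-once) = begin
    r * 2 + e G                                           ≡⟨ cong₂ _+_ (sym (∑-const r 2)) (e≡∑ G) ⟩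
    ∑[ k < r ] 2 + ∑[ x < n ] 𝟙 (isolated? G x)           ≤⟨ +-monoˡ-≤ _ (∑-mono-≤ size≥2) ⟩
    ∑[ k < r ] size (R k) + ∑[ x < n ] 𝟙 (isolated? G x)  ≡⟨ cong (_+ _) (∑-comm (λ k x → 𝟙 (does (x ∈? R k)))) ⟩
    ∑[ x < n ] degree R x + ∑[ x < n ] 𝟙 (isolated? G x)  ≡⟨ ∑-distrib-+ (degree R) _ ⟨
    ∑[ x < n ] (degree R x + 𝟙 (isolated? G x))           ≤⟨ ∑-mono-≤ degree+isolated≤1 ⟩
    ∑[ x < n ] 1                                          ≡⟨ trans (∑-const n 1) (*-identityʳ n) ⟩
    n                                                     ∎
    where
    open ≤-Reasoning
    size≥2 : ∀ k → 2 ≤ size (R k)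
    size≥2 k = let a , b , a≢b , a∈ , b∈ = R-pairs k in 2≤count (_∈? R k) a≢b a∈ b∈
    neighbour-in : ∀ {k x} → x ∈ R k → ∃ λ y → y ∈ R k × Edge G x y
    neighbour-in {k} {x} x∈ = let a , b , a≢b , a∈ , b∈ = R-pairs k
                                  y , y∈ , y≢x = another a≢b a∈ b∈ x
                              in y , y∈ , R-cliques k x y x∈ y∈ (y≢x ∘ sym)
    degree+isolated≤1 : ∀ x → degree R x + 𝟙 (isolated? G x) ≤ 1
    degree+isolated≤1 x with isolated? G x in iso
    ... | true  = ≤-reflexive (cong (_+ 1) (count≡0 (λ k → x ∈? R k)
                    λ k x∈ → isolated⇒¬edge G iso (proj₂ (proj₂ (neighbour-in x∈)))))
    ... | false with ¬isolated⇒edge G iso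
    ...   | p , xp with R-once x p xp
    ...     | k , _ , unique = ≤-trans (≤-reflexive (+-identityʳ _)) (count≤1 (λ k → x ∈? R k) λ {j} x∈ →
                let y , y∈ , xy = neighbour-in x∈ in unique j x∈ (subst (_∈ R j) (M x y p xy xp) y∈))

  linear-bound : ∀ {v} → LinRep G v → n * 3 + e G ≤ v * 2
  linear-bound {v} (F , F-cliques , F-once , F-twice) = begin
    n * 3 + e G                                  ≡⟨ cong₂ _+_ (sym (∑-const n 3)) (e≡∑ G) ⟩
    ∑[ x < n ] 3 + ∑[ x < n ] 𝟙 (isolated? G x)  ≡⟨ ∑-distrib-+ (λ _ → 3) (𝟙 ∘ isolated? G) ⟨
    ∑[ x < n ] (3 + 𝟙 (isolated? G x))           ≤⟨ ∑-mono-≤ vertex-weight ⟩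
    ∑[ x < n ] ∑[ i < v ] weight i x             ≡⟨ ∑-comm (λ x i → weight i x) ⟩
    ∑[ i < v ] ∑[ x < n ] weight i x             ≤⟨ ∑-mono-≤ member-weight ⟩
    ∑[ i < v ] 2                                 ≡⟨ ∑-const v 2 ⟩
    v * 2                                        ∎
    where
    open ≤-Reasoning
    weight : Fin v → Fin n → ℕ
    weight i x = 𝟙 (does (x ∈? F i)) * (3 ∸ size (F i))

    member-weight : ∀ i → ∑[ x < n ] weight i x ≤ 2
    member-weight i = ≤-trans (≤-reflexive (sym (*-distribʳ-sum (3 ∸ size (F i)) (λ x → 𝟙 (does (x ∈? F i))))))
                              (k*[3∸k]≤2 (size (F i)))

    weight-≥ : ∀ {i x s} → x ∈ F i → size (F i) ≤ s → 3 ∸ s ≤ weight i x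
    weight-≥ {i} {x} {s} x∈ size≤s = begin
      3 ∸ s                 ≤⟨ ∸-monoʳ-≤ 3 size≤s ⟩
      3 ∸ size (F i)        ≡⟨ *-identityˡ _ ⟨
      1 * (3 ∸ size (F i))  ≡⟨ cong (_* (3 ∸ size (F i))) (𝟙-yes (x ∈? F i) x∈) ⟨
      weight i x            ∎

    two-weights : ∀ {x i j s t} → i ≢ j → x ∈ F i → x ∈ F j → size (F i) ≤ s → size (F j) ≤ t →
                  (3 ∸ s) + (3 ∸ t) ≤ ∑[ i < v ] weight i x
    two-weights {x} i≢j x∈Fᵢ x∈Fⱼ sizeᵢ sizeⱼ =
      ≤-trans (+-mono-≤ (weight-≥ x∈Fᵢ sizeᵢ) (weight-≥ x∈Fⱼ sizeⱼ)) (f[i]+f[j]≤∑f (λ i → weight i x) i≢j)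

    alone-isolated : ∀ {x i} → isolated? G x ≡ true → x ∈ F i → size (F i) ≤ 1
    alone-isolated {i = i} iso x∈Fᵢ = count≤1 (_∈? F i) (clique-isolated G (F-cliques i) x∈Fᵢ iso)

    with-partner : ∀ {x p i} → Edge G x p → x ∈ F i → size (F i) ≤ 2
    with-partner {i = i} xp x∈Fᵢ = count≤2 (_∈? F i) (clique-partner (F-cliques i) x∈Fᵢ xp)

    alone-without-partner : ∀ {x p i} → Edge G x p → x ∈ F i → p ∉ F i → size (F i) ≤ 1
    alone-without-partner {i = i} xp x∈Fᵢ p∉Fᵢ = count≤1 (_∈? F i) λ y∈Fᵢ →
      [ id , (λ y≡p → ⊥-elim (p∉Fᵢ (subst (_∈ F i) y≡p y∈Fᵢ))) ]′ (clique-partner (F-cliques i) x∈Fᵢ xp y∈Fᵢ)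

    vertex-weight : ∀ x → 3 + 𝟙 (isolated? G x) ≤ ∑[ i < v ] weight i x
    vertex-weight x with F-twice x | isolated? G x in iso
    ... | i₁ , i₂ , i₁≢i₂ , x∈₁ , x∈₂ | true =
      two-weights i₁≢i₂ x∈₁ x∈₂ (alone-isolated iso x∈₁) (alone-isolated iso x∈₂)
    ... | i₁ , i₂ , i₁≢i₂ , x∈₁ , x∈₂ | false with ¬isolated⇒edge G iso
    ...   | p , xp with F-once x p xp
    ...     | k , _ , unique with i₁ ≟ k
    ...       | yes refl = two-weights i₁≢i₂ x∈₁ x∈₂ (with-partner xp x∈₁)
                             (alone-without-partner xp x∈₂ (i₁≢i₂ ∘ sym ∘ unique i₂ x∈₂))
    ...       | no  i₁≢k = two-weights i₁≢i₂ x∈₁ x∈₂ (alone-without-partner xp x∈₁ (i₁≢k ∘ unique i₁ x∈₁))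
                             (with-partner xp x∈₂)

  lower-bound : ∀ {v r} → LinRep G v → RedLinRep G r → r + n + e G ≤ v
  lower-bound {v} {r} F R = *-cancelʳ-≤ _ _ 2 (begin
    (r + n + e G) * 2              ≡⟨ double r n (e G) ⟩
    (r * 2 + e G) + (n * 2 + e G)  ≤⟨ +-monoˡ-≤ _ (reduced-bound R) ⟩
    n + (n * 2 + e G)              ≡⟨ triple n (e G) ⟩
    n * 3 + e G                    ≤⟨ linear-bound F ⟩
    v * 2                          ∎)
    where
    open ≤-Reasoning
    double : ∀ a b c → (a + b + c) * 2 ≡ (a * 2 + c) + (b * 2 + c)
    double = solve-∀
    triple : ∀ b c → b + (b * 2 + c) ≡ b * 3 + c
    triple = solve-∀

mainTheorem14 : (n : ℕ) (G : Graph n) (v vbar : ℕ) →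
    IsLinNum G v → IsRedLinNum G vbar →
    (v ≤ vbar + n + e G) × ((v ≡ vbar + n + e G) ⇔ IsMatchingGraph G)
mainTheorem14 n G v vbar (F , v-minimal) (R@(C , R-cliques , _ , R-once) , _) =
  upper , mk⇔ tight⇒matching (λ M → ≤-antisym upper (Matching.lower-bound {G = G} M F R))
  where
  P : IsCliquePartition G C
  P = cliquePartition R-cliques R-once

  upper : v ≤ vbar + n + e G
  upper = begin
    v                    ≤⟨ v-minimal _ (partition⇒linRep P) ⟩
    vbar + deficit C     ≤⟨ +-monoʳ-≤ vbar (deficit≤n+e P) ⟩
    vbar + (n + e G)     ≡⟨ +-assoc vbar n (e G) ⟨
    vbar + n + e G       ∎
    where open ≤-Reasoning

  tight⇒matching : v ≡ vbar + n + e G → IsMatchingGraph G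
  tight⇒matching v≡ u a b ua ub with a ≟ b
  ... | yes a≡b = a≡b
  ... | no  a≢b = let s , F′ , s< = two-neighbours⇒shorter P ua ub a≢b in
                  ⊥-elim (<-irrefl v≡ (≤-<-trans (v-minimal s F′) s<))
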